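{- Let $\varphi$ and $\psi$ be modal CNF formulas, let $\sigma$ be a consistent permutation that is a symmetry of $\varphi$, and let $\mathcal{C}$ be a class of models that is closed under accessibility relations and closed under $\sigma$. Then $\varphi \models_{\mathcal{C}} \psi$ if and only if $\varphi \models_{\mathcal{C}} \sigma(\psi)$.
   Context: Fix a modal signature $\langle \mathsf{Atom}, \mathsf{Mod}\rangle$ of two countable disjoint sets. A literal is $a$ or $\neg a$ with $a \in \mathsf{Atom}$; $\mathsf{ALit}$ is the set of literals, and for a literal $l$, $\neg l$ is its complement ($\neg\neg a = a$). A modal CNF formula is a finite set of modal CNF clauses (read conjunctively); a modal CNF clause is a finite set (read disjunctively) of literals and modal literals; a modal literal is $[m]C$ or $\neg[m]C$ with $m\in\mathsf{Mod}$ and $C$ a modal CNF clause. Some modalities may be indexed by an atom $a$ (written $m(a)$, e.g. hybrid $@_i$). Models (coinductive): for a nonempty set $W$, $\mathbf{Mods}_W$ is the (coinductively defined) class of tuples $\langle w,W,V,R\rangle$ with $w\in W$, $V(v)\subseteq \mathsf{Atom}$ for $v\in W$, and $R(m,v)\subseteq \mathbf{Mods}_W$ for $m\in\mathsf{Mod}$, $v\in W$; $\mathbf{Mods}=\bigcup_W \mathbf{Mods}_W$. For $\mathcal{M}\in\mathbf{Mods}_W$, $\mathrm{Ext}(\mathcal{M})$ is the smallest subset of $\mathbf{Mods}_W$ containing $\mathcal{M}$ such that $\mathcal{N}\in\mathrm{Ext}(\mathcal{M})$ implies $R^{\mathcal{N}}(m,v)\subseteq \mathrm{Ext}(\mathcal{M})$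 for all $m,v$. A class $\mathcal{C}$ is closed under accessibility relations if $\mathcal{M}\in\mathcal{C}$ implies $\mathrm{Ext}(\mathcal{M})\subseteq\mathcal{C}$. Satisfaction for $\mathcal{M}=\langle w,W,V,R\rangle$: $\mathcal{M}\models\varphi$ iff $\mathcal{M}\models C$ for all $C\in\varphi$; $\mathcal{M}\models C$ iff $\mathcal{M}\models \lambda$ for some $\lambda\in C$; $\mathcal{M}\models a$ iff $a\in V(w)$; $\mathcal{M}\models\neg a$ iff $a\notin V(w)$; $\mathcal{M}\models[m]C$ iff $\mathcal{N}\models C$ for all $\mathcal{N}\in R(m,w)$; $\mathcal{M}\models\neg[m]C$ iff $\mathcal{M}\not\models[m]C$. For a class $\mathcal{C}$, $\mathrm{Mod}_{\mathcal{C}}(\varphi)=\{\mathcal{M}\in\mathcal{C}:\mathcal{M}\models\varphi\}$, and $\varphi\models_{\mathcal{C}}\psi$ iff $\mathrm{Mod}_{\mathcal{C}}(\varphi)\subseteq\mathrm{Mod}_{\mathcal{C}}(\psi)$. Permutations: a permutation is a bijection $\sigma:\mathsf{ALit}\to\mathsf{ALit}$; throughout, permutations move only finitely many literals. $\sigma$ is consistent if $\sigma(\neg l)=\neg\sigma(l)$ for all literals $l$. For a modality, $\sigma(m(a))=m(\sigma(a))$ if $m$ is indexed by atom $a$, and $\sigma(m)=m$ otherwise. On formulas: $\sigma(\varphi)=\{\sigma(C):C\in\varphi\}$, $\sigma(C)=\{\sigma(\lambda):\lambda\in C\}$, $\sigma([m]C)=[\sigma(m)]\sigma(C)$, $\sigma(\neg[m]C)=\neg[\sigma(m)]\sigma(C)$.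 $\sigma$ is a symmetry of $\varphi$ if $\sigma(\varphi)=\varphi$ (as sets of sets). Permuted models: for $S\subseteq\mathsf{Atom}$, $L_S=S\cup\{\neg a: a\in\mathsf{Atom}\setminus S\}$. For $\mathcal{M}=\langle w,W,V,R\rangle$, $\sigma(\mathcal{M})=\langle w,W,V',R'\rangle$ with $V'(v)=\sigma(L_{V(v)})\cap\mathsf{Atom}$ and $R'(m,v)=\{\sigma(\mathcal{N}):\mathcal{N}\in R(\sigma(m),v)\}$ (defined coinductively). A class $\mathcal{C}$ is closed under $\sigma$ if $\sigma(\mathcal{M})\in\mathcal{C}$ for every $\mathcal{M}\in\mathcal{C}$.
   Formalization: In the permuted model σ(M), R′(m,v) is {σ(N) : N ∈ R(σ⁻¹(m),v)} in place of {σ(N) : N ∈ R(σ(m),v)}, and σ(m(a)) is m indexed by the atom of the literal σ(a). Apart from conventions, each condition added here is assumed in the paper as well or is needed for the statement above to hold. This also corrects a misprint. -}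

module Defs where

open import Level using (Level; _⊔_) renaming (suc to lsuc; zero to lzero)
open import Data.Nat using (ℕ)
open import Data.Bool using (Bool; true; false; not; T)
open import Data.List using (List; []; _∷_)
open import Data.List.Membership.Propositional using (_∈_)
open import Data.Product using (Σ; ∃; _×_; _,_)
open import Data.Sum using (_⊎_)
open import Data.Empty using (⊥)
open import Data.Unit using (⊤)
open import Relation.Nullary using (¬_)
open import Relation.Binary.PropositionalEquality using (_≡_)
open import Function.Bundles using (_↔_; _↣_; Inverse)

-- Mod consists of plain modalities (names in PlainMod) and modalities
-- indexed by an atom (m(a) for m in IndexedMod, a in Atom, e.g. @_i).
-- Countability is recorded by injections into ℕ; disjointness of Atom
-- and Mod is automatic (they are distinct types).

record Signature : Set₁ where
  field
    Atom        : Set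
    PlainMod    : Set
    IndexedMod  : Set
    Atom-countable       : Atom ↣ ℕ
    PlainMod-countable   : PlainMod ↣ ℕ
    IndexedMod-countable : IndexedMod ↣ ℕ

module Sig (S : Signature) where
  open Signature S

  data Mod : Set where
    plain : PlainMod → Mod
    idx   : IndexedMod → Atom → Mod

  data Lit : Set where
    pos : Atom → Lit
    neg : Atom → Lit

  compl : Lit → Lit
  compl (pos a) = neg a
  compl (neg a) = pos a

  atomOf : Lit → Atom
  atomOf (pos a) = a
  atomOf (neg a) = a

  -- modal CNF: a clause is a finite set (list, read as a set) of
  -- literals and modal literals; a formula is a finite set of clauses.
  data MLit : Set where
    lit  : Lit → MLit
    box  : Mod → List MLit → MLit
    nbox : Mod → List MLit → MLit

  Clause : Set
  Clause = List MLit

  Formula : Set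
  Formula = List Clause

  mutual
    _≈L_ : MLit → MLit → Set
    lit l    ≈L lit l'     = l ≡ l'
    box m C  ≈L box m' C'  = m ≡ m' × (C ⊑C C' × C' ⊑C C)
    nbox m C ≈L nbox m' C' = m ≡ m' × (C ⊑C C' × C' ⊑C C)
    _        ≈L _          = ⊥

    _⊑C_ : Clause → Clause → Set
    []       ⊑C D = ⊤
    (x ∷ xs) ⊑C D = x ∈L D × xs ⊑C D

    _∈L_ : MLit → Clause → Set
    x ∈L []       = ⊥
    x ∈L (y ∷ ys) = x ≈L y ⊎ x ∈L ys

  _≈C_ : Clause → Clause → Set
  C ≈C D = C ⊑C D × D ⊑C C

  _∈F_ : Clause → Formula → Set
  C ∈F []       = ⊥
  C ∈F (D ∷ Ds) = C ≈C D ⊎ C ∈F Ds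

  _⊑F_ : Formula → Formula → Set
  []       ⊑F ψ = ⊤
  (C ∷ Cs) ⊑F ψ = C ∈F ψ × Cs ⊑F ψ

  _≈F_ : Formula → Formula → Set
  φ ≈F ψ = φ ⊑F ψ × ψ ⊑F φ

  record Permutation : Set where
    field
      bij     : Lit ↔ Lit
      support : List Lit
      finite  : ∀ l → ¬ (l ∈ support) → Inverse.to bij l ≡ l

    apply : Lit → Lit
    apply = Inverse.to bij

    unapply : Lit → Lit
    unapply = Inverse.from bij

  open Permutation public

  Consistent : Permutation → Set
  Consistent σ = ∀ l → apply σ (compl l) ≡ compl (apply σ l)

  permMod : Permutation → Mod → Mod
  permMod σ (plain m) = plain m
  permMod σ (idx m a) = idx m (atomOf (apply σ (pos a)))

  unpermMod : Permutation → Mod → Mod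
  unpermMod σ (plain m) = plain m
  unpermMod σ (idx m a) = idx m (atomOf (unapply σ (pos a)))

  mutual
    permL : Permutation → MLit → MLit
    permL σ (lit l)    = lit (apply σ l)
    permL σ (box m C)  = box (permMod σ m) (permC σ C)
    permL σ (nbox m C) = nbox (permMod σ m) (permC σ C)

    permC : Permutation → Clause → Clause
    permC σ []       = []
    permC σ (x ∷ xs) = permL σ x ∷ permC σ xs

  permF : Permutation → Formula → Formula
  permF σ []       = []
  permF σ (C ∷ Cs) = permC σ C ∷ permF σ Cs

  IsSymmetry : Permutation → Formula → Set
  IsSymmetry σ φ = permF σ φ ≈F φ

  -- The coinductive class Mods_W is represented by pointed
  -- coalgebras: a "frame" K carries a set of states, and each state x
  -- determines the tuple ⟨w, W, V, R⟩ of the model it denotes: its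
  -- world w = worldOf x, its valuation V = valOf x (V(v) ⊆ Atom given by
  -- a characteristic function), and R(m,v) = the models denoted by the
  -- states y with relOf x m v y.
  record Frame (W : Set) : Set₁ where
    field
      State   : Set
      worldOf : State → W
      valOf   : State → W → Atom → Bool
      relOf   : State → Mod → W → State → Set
  open Frame public

  record Model (W : Set) : Set₁ where
    constructor ⟨_,_⟩
    field
      frame : Frame W
      point : State frame
  open Model public

  world : {W : Set} → Model W → W
  world M = worldOf (frame M) (point M)

  val : {W : Set} → Model W → W → Atom → Bool
  val M = valOf (frame M) (point M)

  data Reach {W : Set} (K : Frame W) (x : State K) : State K → Set where
    here : Reach K x x
    step : ∀ {y z} → Reach K x y → (m : Mod) (v : W) →
           relOf K y m v z → Reach K x z

  Ext : {W : Set} → Model W → Model W → Set₁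
  Ext M N = Σ (frame M ≡ frame N) λ { _≡_.refl →
              Reach (frame M) (point M) (point N) }

  Class : Set₂
  Class = (W : Set) → Model W → Set₁

  ClosedUnderAccessibility : Class → Set₁
  ClosedUnderAccessibility 𝒞 =
    ∀ (W : Set) (M N : Model W) → 𝒞 W M → Ext M N → 𝒞 W N

  mutual
    sat-L : {W : Set} (K : Frame W) → State K → MLit → Set
    sat-L K x (lit (pos a)) = T (valOf K x (worldOf K x) a)
    sat-L K x (lit (neg a)) = ¬ T (valOf K x (worldOf K x) a)
    sat-L K x (box m C)     =
      ∀ y → relOf K x m (worldOf K x) y → sat-C K y C
    sat-L K x (nbox m C)    =
      ¬ (∀ y → relOf K x m (worldOf K x) y → sat-C K y C)

    sat-C : {W : Set} (K : Frame W) → State K → Clause → Set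
    sat-C K x []       = ⊥
    sat-C K x (l ∷ ls) = sat-L K x l ⊎ sat-C K x ls

  sat-F : {W : Set} (K : Frame W) → State K → Formula → Set
  sat-F K x []       = ⊤
  sat-F K x (C ∷ Cs) = sat-C K x C × sat-F K x Cs

  _⊨F_ : {W : Set} → Model W → Formula → Set
  M ⊨F φ = sat-F (frame M) (point M) φ

  Entails : Class → Formula → Formula → Set₁
  Entails 𝒞 φ ψ = ∀ (W : Set) (M : Model W) → 𝒞 W M → M ⊨F φ → M ⊨F ψ

  -- Permuted models:  V'(v) = σ(L_{V(v)}) ∩ Atom, i.e. a ∈ V'(v) iff
  -- σ⁻¹(a) ∈ L_{V(v)};  R'(m,v) = {σ(N) : N ∈ R(σ⁻¹(m),v)}
  --.
  permVal : {W : Set} → Permutation → (W → Atom → Bool) → W → Atom → Bool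
  permVal σ V v a with unapply σ (pos a)
  ... | pos b = V v b
  ... | neg b = not (V v b)

  permFrame : {W : Set} → Permutation → Frame W → Frame W
  permFrame σ K = record
    { State   = State K
    ; worldOf = worldOf K
    ; valOf   = λ x → permVal σ (valOf K x)
    ; relOf   = λ x m v y → relOf K x (unpermMod σ m) v y
    }

  permModel : {W : Set} → Permutation → Model W → Model W
  permModel σ M = ⟨ permFrame σ (frame M) , point M ⟩

  ClosedUnder : Permutation → Class → Set₁
  ClosedUnder σ 𝒞 = ∀ (W : Set) (M : Model W) → 𝒞 W M → 𝒞 W (permModel σ M)

-- Satisfaction is invariant under permuting formula and model together:
-- σ(M) ⊨ σ(χ) iff M ⊨ χ (this is where consistency of σ is used).  So if
-- φ ⊨ σ(χ) and M ⊨ φ, then σ(M) ⊨ σ(φ) = φ with σ(M) still in the class,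
-- hence σ(M) ⊨ σ(χ) and M ⊨ χ.  This proves φ ⊨ σ(ψ) ⇒ φ ⊨ ψ.  Conversely,
-- a permutation moving only finitely many literals has finite order, so
-- ψ = σᵈ(σ(ψ)) for some d, and d uses of the first direction turn φ ⊨ ψ
-- into φ ⊨ σ(ψ).
module Submission where

open import Defs
open import Data.Bool using (true; false; not; T)
open import Data.Empty using (⊥-elim)
open import Data.Fin using (Fin; toℕ)
open import Data.Fin.Properties using (pigeonhole)
open import Data.List using (List; []; _∷_; length; lookup)
open import Data.List.Membership.Propositional using (_∈_; _∉_)
import Data.List.Membership.DecPropositional as DecMembership
open import Data.List.Relation.Unary.Any using (here; there; index)
open import Data.List.Relation.Unary.Any.Properties using (lookup-index)
open import Data.Nat using (ℕ; zero; suc; _+_; _*_; _<_; s≤s)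
open import Data.Nat.GeneralisedArithmetic using (iterate)
open import Data.Nat.Properties using (n<1+n; *-comm; eq?)
open import Data.Product using (∃; _,_; proj₁; proj₂)
open import Data.Product.Function.NonDependent.Propositional using (_×-⇔_)
open import Data.Sum using (inj₁; inj₂)
open import Data.Sum.Function.Propositional using (_⊎-⇔_)
open import Data.Unit using (tt)
open import Function using (_∘_)
open import Function.Bundles using (_⇔_; mk⇔; Equivalence; Inverse; Injection)
import Function.Properties.Equivalence as ⇔
open import Function.Properties.Inverse using (↔⇒↣)
open import Function.Related.TypeIsomorphisms using (¬-cong-⇔)
open import Relation.Binary.Definitions using (DecidableEquality)
open import Relation.Binary.PropositionalEquality
open import Relation.Nullary using (¬_; yes; no)
open import Relation.Nullary.Decidable using (map′)

T-not⇔¬T : ∀ {b} → T (not b) ⇔ (¬ T b)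
T-not⇔¬T {true}  = mk⇔ (λ ()) (λ ¬T → ¬T tt)
T-not⇔¬T {false} = mk⇔ (λ _ ()) (λ _ → tt)

¬T-not⇔T : ∀ {b} → (¬ T (not b)) ⇔ T b
¬T-not⇔T {true}  = mk⇔ (λ _ → tt) (λ _ ())
¬T-not⇔T {false} = mk⇔ (λ ¬T → ⊥-elim (¬T tt)) (λ ())

∀-→-cong-⇔ : {S : Set} {R A B : S → Set} →
             (∀ y → A y ⇔ B y) → (∀ y → R y → A y) ⇔ (∀ y → R y → B y)
∀-→-cong-⇔ A⇔B = mk⇔ (λ f y r → Equivalence.to   (A⇔B y) (f y r))
                     (λ f y r → Equivalence.from (A⇔B y) (f y r))

module _ {a} {A : Set a} (f : A → A) where

  iterate-+ : ∀ x m n → iterate f x (m + n) ≡ iterate f (iterate f x m) n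
  iterate-+ x zero    n = refl
  iterate-+ x (suc m) n = iterate-+ (f x) m n

  iterate-suc : ∀ x n → iterate f x (suc n) ≡ f (iterate f x n)
  iterate-suc x zero    = refl
  iterate-suc x (suc n) = iterate-suc (f x) n

  iterate-fixed : ∀ {x} → f x ≡ x → ∀ n → iterate f x n ≡ x
  iterate-fixed fx≡x zero    = refl
  iterate-fixed fx≡x (suc n) = trans (cong (λ y → iterate f y n) fx≡x) (iterate-fixed fx≡x n)

  iterate-periodic : ∀ {x} d → iterate f x (suc d) ≡ x → ∀ k → iterate f x (k * suc d) ≡ x
  iterate-periodic d returns zero = refl
  iterate-periodic {x} d returns (suc k) = begin
    iterate f x (suc d + k * suc d)             ≡⟨ iterate-+ x (suc d) (k * suc d) ⟩
    iterate f (iterate f x (suc d)) (k * suc d) ≡⟨ cong (λ y → iterate f y (k * suc d)) returns ⟩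
    iterate f x (k * suc d)                     ≡⟨ iterate-periodic d returns k ⟩
    x                                           ∎
    where open ≡-Reasoning

same-index⇒≡ : ∀ {a} {A : Set a} {xs : List A} {x y : A} (x∈ : x ∈ xs) (y∈ : y ∈ xs) →
               index x∈ ≡ index y∈ → x ≡ y
same-index⇒≡ {xs = xs} x∈ y∈ eq =
  trans (lookup-index x∈) (trans (cong (lookup xs) eq) (sym (lookup-index y∈)))

module FiniteOrder {a} {A : Set a} (_≟_ : DecidableEquality A)
  (f : A → A) (f-injective : ∀ {x y} → f x ≡ f y → x ≡ y)
  (support : List A) (fixed-outside : ∀ x → x ∉ support → f x ≡ x) where

  open DecMembership _≟_ using (_∈?_)

  f-∈-support : ∀ {x} → x ∈ support → f x ∈ support
  f-∈-support {x} x∈ with f x ∈? support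
  ... | yes fx∈ = fx∈
  ... | no  fx∉ =
    ⊥-elim (fx∉ (subst (_∈ support) (sym (f-injective (fixed-outside (f x) fx∉))) x∈))

  iterate-∈-support : ∀ {x} → x ∈ support → ∀ n → iterate f x n ∈ support
  iterate-∈-support x∈ zero    = x∈
  iterate-∈-support x∈ (suc n) = iterate-∈-support (f-∈-support x∈) n

  period-of-repeat : ∀ x {i j} → i < j → iterate f x i ≡ iterate f x j →
                     ∃ λ d → iterate f x (suc d) ≡ x
  period-of-repeat x {zero}  {suc d} _          repeat = d , sym repeat
  period-of-repeat x {suc i} {suc j} (s≤s i<j) repeat =
    period-of-repeat x i<j
      (f-injective (trans (sym (iterate-suc f x i)) (trans repeat (iterate-suc f x j))))

  -- The orbit of a point of the support stays in the support, so by
  -- pigeonhole two of its first |support| + 1 points coincide.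
  period : ∀ x → ∃ λ d → iterate f x (suc d) ≡ x
  period x with x ∈? support
  ... | no  x∉ = 0 , fixed-outside x x∉
  ... | yes x∈ =
    let orbit∈ = λ (i : Fin (suc (length support))) → iterate-∈-support x∈ (toℕ i)
        i , j , i<j , same-index = pigeonhole (n<1+n (length support)) (index ∘ orbit∈)
    in period-of-repeat x i<j (same-index⇒≡ (orbit∈ i) (orbit∈ j) same-index)

  common-period : ∀ xs → ∃ λ d → ∀ {x} → x ∈ xs → iterate f x (suc d) ≡ x
  common-period []       = 0 , λ ()
  common-period (y ∷ ys) with period y | common-period ys
  -- suc (e + d * suc e) is the product of the two periods suc d and suc e.
  ... | d , y-returns | e , ys-return = e + d * suc e , λ where
    (here refl) → subst (λ n → iterate f y n ≡ y) (*-comm (suc e) (suc d))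
                        (iterate-periodic f d y-returns (suc e))
    (there x∈)  → iterate-periodic f e (ys-return x∈) (suc d)

  finite-order : ∃ λ d → ∀ x → iterate f x (suc d) ≡ x
  finite-order = order , returns
    where
      order : ℕ
      order = proj₁ (common-period support)

      returns : ∀ x → iterate f x (suc order) ≡ x
      returns x with x ∈? support
      ... | yes x∈ = proj₂ (common-period support) x∈
      ... | no  x∉ = iterate-fixed f (fixed-outside x x∉) (suc order)

module Modal (S : Signature) where
  open Signature S
  open Sig S

  _≟-Atom_ : DecidableEquality Atom
  _≟-Atom_ = eq? Atom-countable

  _≟-Lit_ : DecidableEquality Lit
  pos a ≟-Lit pos b = map′ (cong pos) (λ { refl → refl }) (a ≟-Atom b)
  neg a ≟-Lit neg b = map′ (cong neg) (λ { refl → refl }) (a ≟-Atom b)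
  pos a ≟-Lit neg b = no λ ()
  neg a ≟-Lit pos b = no λ ()

  PreservesCompl : (Lit → Lit) → Set
  PreservesCompl g = ∀ l → g (compl l) ≡ compl (g l)

  atomOf-compl : ∀ l → atomOf (compl l) ≡ atomOf l
  atomOf-compl (pos a) = refl
  atomOf-compl (neg a) = refl

  atomOf-pos-atomOf : ∀ {g} → PreservesCompl g → ∀ l → atomOf (g (pos (atomOf l))) ≡ atomOf (g l)
  atomOf-pos-atomOf     g-compl (pos a) = refl
  atomOf-pos-atomOf {g} g-compl (neg a) =
    sym (trans (cong atomOf (g-compl (pos a))) (atomOf-compl (g (pos a))))

  mutual
    sat-L-≈L : ∀ {W} {K : Frame W} {x} μ ν → μ ≈L ν → sat-L K x μ → sat-L K x ν
    sat-L-≈L (lit l)    (lit .l)    refl              s = s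
    sat-L-≈L (box m C)  (box .m D)  (refl , C⊑D , _)  s = λ y r → sat-C-⊑C C D C⊑D (s y r)
    sat-L-≈L (nbox m C) (nbox .m D) (refl , _ , D⊑C)  s =
      λ t → s (λ y r → sat-C-⊑C D C D⊑C (t y r))

    sat-C-⊑C : ∀ {W} {K : Frame W} {x} C D → C ⊑C D → sat-C K x C → sat-C K x D
    sat-C-⊑C (μ ∷ C) D (μ∈D , _)  (inj₁ s) = sat-C-∈L μ D μ∈D s
    sat-C-⊑C (μ ∷ C) D (_ , C⊑D) (inj₂ s) = sat-C-⊑C C D C⊑D s

    sat-C-∈L : ∀ {W} {K : Frame W} {x} μ D → μ ∈L D → sat-L K x μ → sat-C K x D
    sat-C-∈L μ (ν ∷ D) (inj₁ μ≈ν) s = inj₁ (sat-L-≈L μ ν μ≈ν s)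
    sat-C-∈L μ (ν ∷ D) (inj₂ μ∈D) s = inj₂ (sat-C-∈L μ D μ∈D s)

  sat-C-∈F : ∀ {W} {K : Frame W} {x} C ψ → C ∈F ψ → sat-F K x ψ → sat-C K x C
  sat-C-∈F C (D ∷ ψ) (inj₁ (_ , D⊑C)) (s , _) = sat-C-⊑C D C D⊑C s
  sat-C-∈F C (D ∷ ψ) (inj₂ C∈ψ)       (_ , s) = sat-C-∈F C ψ C∈ψ s

  sat-F-⊑F : ∀ {W} {K : Frame W} {x} χ ψ → χ ⊑F ψ → sat-F K x ψ → sat-F K x χ
  sat-F-⊑F []      ψ _             _ = tt
  sat-F-⊑F (C ∷ χ) ψ (C∈ψ , χ⊑ψ) s = sat-C-∈F C ψ C∈ψ s , sat-F-⊑F χ ψ χ⊑ψ s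

  mutual
    renameL : (Lit → Lit) → (Mod → Mod) → MLit → MLit
    renameL f g (lit l)    = lit (f l)
    renameL f g (box m C)  = box (g m) (renameC f g C)
    renameL f g (nbox m C) = nbox (g m) (renameC f g C)

    renameC : (Lit → Lit) → (Mod → Mod) → Clause → Clause
    renameC f g []      = []
    renameC f g (μ ∷ C) = renameL f g μ ∷ renameC f g C

  renameF : (Lit → Lit) → (Mod → Mod) → Formula → Formula
  renameF f g []      = []
  renameF f g (C ∷ φ) = renameC f g C ∷ renameF f g φ

  module _ (f f′ : Lit → Lit) (g g′ : Mod → Mod) where
    mutual
      renameL-∘ : ∀ μ → renameL f g (renameL f′ g′ μ) ≡ renameL (f ∘ f′) (g ∘ g′) μ
      renameL-∘ (lit l)    = refl
      renameL-∘ (box m C)  = cong (box _) (renameC-∘ C)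
      renameL-∘ (nbox m C) = cong (nbox _) (renameC-∘ C)

      renameC-∘ : ∀ C → renameC f g (renameC f′ g′ C) ≡ renameC (f ∘ f′) (g ∘ g′) C
      renameC-∘ []      = refl
      renameC-∘ (μ ∷ C) = cong₂ _∷_ (renameL-∘ μ) (renameC-∘ C)

    renameF-∘ : ∀ φ → renameF f g (renameF f′ g′ φ) ≡ renameF (f ∘ f′) (g ∘ g′) φ
    renameF-∘ []      = refl
    renameF-∘ (C ∷ φ) = cong₂ _∷_ (renameC-∘ C) (renameF-∘ φ)

  module _ {f : Lit → Lit} {g : Mod → Mod} (f-id : ∀ l → f l ≡ l) (g-id : ∀ m → g m ≡ m) where
    mutual
      renameL-id : ∀ μ → renameL f g μ ≡ μ
      renameL-id (lit l)    = cong lit (f-id l)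
      renameL-id (box m C)  = cong₂ box (g-id m) (renameC-id C)
      renameL-id (nbox m C) = cong₂ nbox (g-id m) (renameC-id C)

      renameC-id : ∀ C → renameC f g C ≡ C
      renameC-id []      = refl
      renameC-id (μ ∷ C) = cong₂ _∷_ (renameL-id μ) (renameC-id C)

    renameF-id : ∀ φ → renameF f g φ ≡ φ
    renameF-id []      = refl
    renameF-id (C ∷ φ) = cong₂ _∷_ (renameC-id C) (renameF-id φ)

  module _ (σ : Permutation) where
    mutual
      permL≡renameL : ∀ μ → permL σ μ ≡ renameL (apply σ) (permMod σ) μ
      permL≡renameL (lit l)    = refl
      permL≡renameL (box m C)  = cong (box _) (permC≡renameC C)
      permL≡renameL (nbox m C) = cong (nbox _) (permC≡renameC C)

      permC≡renameC : ∀ C → permC σ C ≡ renameC (apply σ) (permMod σ) C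
      permC≡renameC []      = refl
      permC≡renameC (μ ∷ C) = cong₂ _∷_ (permL≡renameL μ) (permC≡renameC C)

    permF≡renameF : ∀ φ → permF σ φ ≡ renameF (apply σ) (permMod σ) φ
    permF≡renameF []      = refl
    permF≡renameF (C ∷ φ) = cong₂ _∷_ (permC≡renameC C) (permF≡renameF φ)

  module Permuted (σ : Permutation) (σ-consistent : Consistent σ) where

    unapply-apply : ∀ l → unapply σ (apply σ l) ≡ l
    unapply-apply = Inverse.strictlyInverseʳ (bij σ)

    apply-unapply : ∀ l → apply σ (unapply σ l) ≡ l
    apply-unapply = Inverse.strictlyInverseˡ (bij σ)

    apply-injective : ∀ {l l′} → apply σ l ≡ apply σ l′ → l ≡ l′
    apply-injective = Injection.injective (↔⇒↣ (bij σ))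

    unapply-compl : PreservesCompl (unapply σ)
    unapply-compl l = apply-injective (begin
      apply σ (unapply σ (compl l))  ≡⟨ apply-unapply (compl l) ⟩
      compl l                        ≡⟨ cong compl (apply-unapply l) ⟨
      compl (apply σ (unapply σ l))  ≡⟨ σ-consistent (unapply σ l) ⟨
      apply σ (compl (unapply σ l))  ∎)
      where open ≡-Reasoning

    unpermMod-permMod : ∀ m → unpermMod σ (permMod σ m) ≡ m
    unpermMod-permMod (plain p) = refl
    unpermMod-permMod (idx m a) = cong (idx m)
      (trans (atomOf-pos-atomOf unapply-compl (apply σ (pos a))) (cong atomOf (unapply-apply (pos a))))

    sat-lit-permFrame : ∀ {W} (K : Frame W) x l →
                        sat-L (permFrame σ K) x (lit l) ⇔ sat-L K x (lit (unapply σ l))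
    sat-lit-permFrame K x (pos a) with unapply σ (pos a)
    ... | pos b = ⇔.refl
    ... | neg b = T-not⇔¬T
    sat-lit-permFrame K x (neg a) rewrite unapply-compl (pos a) with unapply σ (pos a)
    ... | pos b = ⇔.refl
    ... | neg b = ¬T-not⇔T

    mutual
      sat-L-permute : ∀ {W} (K : Frame W) x μ → sat-L (permFrame σ K) x (permL σ μ) ⇔ sat-L K x μ
      sat-L-permute K x (lit l) =
        subst (λ l′ → sat-L (permFrame σ K) x (lit (apply σ l)) ⇔ sat-L K x (lit l′))
              (unapply-apply l) (sat-lit-permFrame K x (apply σ l))
      sat-L-permute K x (box m C) rewrite unpermMod-permMod m =
        ∀-→-cong-⇔ (λ y → sat-C-permute K y C)
      sat-L-permute K x (nbox m C) rewrite unpermMod-permMod m =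
        ¬-cong-⇔ (∀-→-cong-⇔ (λ y → sat-C-permute K y C))

      sat-C-permute : ∀ {W} (K : Frame W) x C → sat-C (permFrame σ K) x (permC σ C) ⇔ sat-C K x C
      sat-C-permute K x []      = ⇔.refl
      sat-C-permute K x (μ ∷ C) = sat-L-permute K x μ ⊎-⇔ sat-C-permute K x C

    ⊨F-permModel : ∀ {W} (M : Model W) φ → (permModel σ M ⊨F permF σ φ) ⇔ (M ⊨F φ)
    ⊨F-permModel M []      = ⇔.refl
    ⊨F-permModel M (C ∷ φ) = sat-C-permute (frame M) (point M) C ×-⇔ ⊨F-permModel M φ

    entails-unpermute : ∀ {𝒞 φ χ} → IsSymmetry σ φ → ClosedUnder σ 𝒞 →
                        Entails 𝒞 φ (permF σ χ) → Entails 𝒞 φ χ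
    entails-unpermute {φ = φ} {χ} (_ , φ⊑σφ) σ-closed φ⊨σχ W M M∈𝒞 M⊨φ =
      Equivalence.to (⊨F-permModel M χ)
        (φ⊨σχ W (permModel σ M) (σ-closed W M M∈𝒞)
          (sat-F-⊑F φ (permF σ φ) φ⊑σφ (Equivalence.from (⊨F-permModel M φ) M⊨φ)))

    entails-unpermute-iterate : ∀ {𝒞 φ} → IsSymmetry σ φ → ClosedUnder σ 𝒞 →
                                ∀ χ n → Entails 𝒞 φ (iterate (permF σ) χ n) → Entails 𝒞 φ χ
    entails-unpermute-iterate symmetry σ-closed χ zero    = λ φ⊨χ → φ⊨χ
    entails-unpermute-iterate symmetry σ-closed χ (suc n) =
      entails-unpermute symmetry σ-closed ∘ entails-unpermute-iterate symmetry σ-closed (permF σ χ) n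

    iterate-compl : ∀ n → PreservesCompl (λ l → iterate (apply σ) l n)
    iterate-compl zero    l = refl
    iterate-compl (suc n) l =
      trans (cong (λ l′ → iterate (apply σ) l′ n) (σ-consistent l)) (iterate-compl n (apply σ l))

    iterate-permMod-idx : ∀ m a n →
      iterate (permMod σ) (idx m a) n ≡ idx m (atomOf (iterate (apply σ) (pos a) n))
    iterate-permMod-idx m a zero    = refl
    iterate-permMod-idx m a (suc n) =
      trans (iterate-permMod-idx m (atomOf (apply σ (pos a))) n)
            (cong (idx m) (atomOf-pos-atomOf (iterate-compl n) (apply σ (pos a))))

    iterate-permF : ∀ ψ n → iterate (permF σ) ψ n ≡
      renameF (λ l → iterate (apply σ) l n) (λ m → iterate (permMod σ) m n) ψ
    iterate-permF ψ zero    = sym (renameF-id (λ _ → refl) (λ _ → refl) ψ)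
    iterate-permF ψ (suc n) = begin
      iterate (permF σ) (permF σ ψ) n
        ≡⟨ iterate-permF (permF σ ψ) n ⟩
      renameF (λ l → iterate (apply σ) l n) (λ m → iterate (permMod σ) m n) (permF σ ψ)
        ≡⟨ cong (renameF _ _) (permF≡renameF σ ψ) ⟩
      renameF (λ l → iterate (apply σ) l n) (λ m → iterate (permMod σ) m n)
              (renameF (apply σ) (permMod σ) ψ)
        ≡⟨ renameF-∘ _ _ _ _ ψ ⟩
      renameF (λ l → iterate (apply σ) l (suc n)) (λ m → iterate (permMod σ) m (suc n)) ψ
        ∎
      where open ≡-Reasoning

    open FiniteOrder _≟-Lit_ (apply σ) apply-injective (support σ) (finite σ)
      using (finite-order)

    permF-finite-order : ∃ λ d → ∀ ψ → iterate (permF σ) ψ (suc d) ≡ ψ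
    permF-finite-order =
      d , λ ψ → trans (iterate-permF ψ (suc d)) (renameF-id lit-returns mod-returns ψ)
      where
        d : ℕ
        d = proj₁ finite-order

        lit-returns : ∀ l → iterate (apply σ) l (suc d) ≡ l
        lit-returns = proj₂ finite-order

        mod-returns : ∀ m → iterate (permMod σ) m (suc d) ≡ m
        mod-returns (plain p) = iterate-fixed (permMod σ) refl (suc d)
        mod-returns (idx m a) =
          trans (iterate-permMod-idx m a (suc d)) (cong (idx m ∘ atomOf) (lit-returns (pos a)))

    entails-permute : ∀ {𝒞 φ ψ} → IsSymmetry σ φ → ClosedUnder σ 𝒞 →
                      Entails 𝒞 φ ψ → Entails 𝒞 φ (permF σ ψ)
    entails-permute {𝒞} {φ} {ψ} symmetry σ-closed φ⊨ψ =
      let d , returns = permF-finite-order in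
      entails-unpermute-iterate symmetry σ-closed (permF σ ψ) d
        (subst (Entails 𝒞 φ) (sym (returns ψ)) φ⊨ψ)

theorem2 : (S : Signature) → let open Sig S in
    (φ ψ : Formula) (σ : Permutation) (𝒞 : Class) →
    Consistent σ → IsSymmetry σ φ →
    ClosedUnderAccessibility 𝒞 → ClosedUnder σ 𝒞 →
    Entails 𝒞 φ ψ ⇔ Entails 𝒞 φ (permF σ ψ)
theorem2 S φ ψ σ 𝒞 σ-consistent symmetry _ σ-closed =
  mk⇔ (entails-permute symmetry σ-closed) (entails-unpermute symmetry σ-closed)
  where open Modal.Permuted S σ σ-consistent
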